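{- Let $\mathbf A\in\mathbf{I}_{2,0}$ and $a\in A$. If $0\sqsubseteq a$, then $0\to a=0'$.
   Context: A zroupoid is an algebra $\langle A,\to,0\rangle$ with binary $\to$ and constant $0$; $x':=x\to 0$. An implication zroupoid satisfies (I) $(x\to y)\to z\approx[(z'\to x)\to(y\to z)']'$ and $0''\approx 0$; $\mathbf{I}_{2,0}$ is the variety of implication zroupoids satisfying $x''\approx x$. For $x,y\in A$, $x\sqsubseteq y$ iff $(x\to y')'=x$. -}

module Defs where

open import Level using (Level; suc)
open import Relation.Binary.PropositionalEquality using (_≡_)

-- A zroupoid ⟨A, →, 0⟩ in the variety I_{2,0}:
-- implication zroupoid (identity (I) and 0'' ≈ 0) satisfying x'' ≈ x.
record I20 (a : Level) : Set (suc a) where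
  infixr 5 _⇒_
  field
    A    : Set a
    _⇒_  : A → A → A
    𝟎    : A

  _′ : A → A
  x ′ = x ⇒ 𝟎

  field
    ident-I : ∀ x y z → (x ⇒ y) ⇒ z ≡ (((z ′) ⇒ x) ⇒ ((y ⇒ z) ′)) ′
    zero″   : (𝟎 ′) ′ ≡ 𝟎
    invol   : ∀ x → (x ′) ′ ≡ x

  _⊑_ : A → A → Set a
  x ⊑ y = (x ⇒ (y ′)) ′ ≡ x

module Submission where

-- Write 1 := 0′.  The proof rests on three identities valid in every algebra
-- of I_{2,0}, each an instance of (I) simplified by the involution x″ = x:
--   * 1 is a left unit:             1 → x = x;
--   * a dualisation law:            x′ → 1 = 0 → x;
--   * a double-arrow law:           (x → 1) → 1 = 0 → x.
-- The hypothesis 0 ⊑ a says (0 → a′)′ = 0, i.e. 0 → a′ = 1; by the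
-- dualisation law (applied to a′) this means a → 1 = 1.  Feeding this into
-- the double-arrow law gives 0 → a = (a → 1) → 1 = 1 → 1 = 1.

open import Defs
open import Level using (Level)
open import Relation.Binary.PropositionalEquality
  using (_≡_; sym; cong; cong₂; module ≡-Reasoning)

module I20-Identities {ℓ : Level} (𝐀 : I20 ℓ) where
  open I20 𝐀
  open ≡-Reasoning

  𝟏 : A
  𝟏 = 𝟎 ′

  𝟏′≡𝟎 : 𝟏 ′ ≡ 𝟎
  𝟏′≡𝟎 = invol 𝟎

  𝟏-unitˡ : ∀ x → 𝟏 ⇒ x ≡ x
  𝟏-unitˡ x = sym (begin
      x                         ≡⟨ sym (invol x) ⟩
      (x ⇒ 𝟎) ⇒ 𝟎               ≡⟨ ident-I x 𝟎 𝟎 ⟩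
      ((𝟏 ⇒ x) ⇒ 𝟏 ′) ′         ≡⟨ cong (λ t → ((𝟏 ⇒ x) ⇒ t) ′) 𝟏′≡𝟎 ⟩
      ((𝟏 ⇒ x) ′) ′             ≡⟨ invol _ ⟩
      𝟏 ⇒ x                     ∎)

  𝟎⇒𝟏 : 𝟎 ⇒ 𝟏 ≡ 𝟏
  𝟎⇒𝟏 = sym (begin
      𝟏                             ≡⟨ sym (𝟏-unitˡ 𝟏) ⟩
      𝟏 ⇒ 𝟏                         ≡⟨ ident-I 𝟎 𝟎 𝟏 ⟩
      ((𝟏 ′ ⇒ 𝟎) ⇒ (𝟎 ⇒ 𝟏) ′) ′     ≡⟨ cong (λ t → ((t ⇒ 𝟎) ⇒ (𝟎 ⇒ 𝟏) ′) ′) 𝟏′≡𝟎 ⟩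
      (𝟏 ⇒ (𝟎 ⇒ 𝟏) ′) ′             ≡⟨ cong _′ (𝟏-unitˡ _) ⟩
      ((𝟎 ⇒ 𝟏) ′) ′                 ≡⟨ invol _ ⟩
      𝟎 ⇒ 𝟏                         ∎)

  ′⇒𝟏 : ∀ x → x ′ ⇒ 𝟏 ≡ 𝟎 ⇒ x
  ′⇒𝟏 x = begin
      x ′ ⇒ 𝟏                       ≡⟨ ident-I x 𝟎 𝟏 ⟩
      ((𝟏 ′ ⇒ x) ⇒ (𝟎 ⇒ 𝟏) ′) ′     ≡⟨ cong₂ (λ s t → ((s ⇒ x) ⇒ t ′) ′) 𝟏′≡𝟎 𝟎⇒𝟏 ⟩
      ((𝟎 ⇒ x) ⇒ 𝟏 ′) ′             ≡⟨ cong (λ t → ((𝟎 ⇒ x) ⇒ t) ′) 𝟏′≡𝟎 ⟩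
      ((𝟎 ⇒ x) ′) ′                 ≡⟨ invol _ ⟩
      𝟎 ⇒ x                         ∎

  ⇒𝟏⇒𝟏 : ∀ x → (x ⇒ 𝟏) ⇒ 𝟏 ≡ 𝟎 ⇒ x
  ⇒𝟏⇒𝟏 x = begin
      (x ⇒ 𝟏) ⇒ 𝟏                   ≡⟨ ident-I x 𝟏 𝟏 ⟩
      ((𝟏 ′ ⇒ x) ⇒ (𝟏 ⇒ 𝟏) ′) ′     ≡⟨ cong (λ t → ((𝟏 ′ ⇒ x) ⇒ t ′) ′) (𝟏-unitˡ 𝟏) ⟩
      ((𝟏 ′ ⇒ x) ⇒ 𝟏 ′) ′           ≡⟨ cong (λ t → ((t ⇒ x) ⇒ t) ′) 𝟏′≡𝟎 ⟩
      ((𝟎 ⇒ x) ′) ′                 ≡⟨ invol _ ⟩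
      𝟎 ⇒ x                         ∎

  𝟎⊑⇒⇒𝟏 : ∀ a → 𝟎 ⊑ a → a ⇒ 𝟏 ≡ 𝟏
  𝟎⊑⇒⇒𝟏 a 𝟎⊑a = begin
      a ⇒ 𝟏             ≡⟨ cong (_⇒ 𝟏) (sym (invol a)) ⟩
      (a ′) ′ ⇒ 𝟏       ≡⟨ ′⇒𝟏 (a ′) ⟩
      𝟎 ⇒ a ′           ≡⟨ sym (invol _) ⟩
      ((𝟎 ⇒ a ′) ′) ′   ≡⟨ cong _′ 𝟎⊑a ⟩
      𝟏                 ∎

lemma5p3 : ∀ {ℓ : Level} (𝐀 : I20 ℓ) (a : I20.A 𝐀) → I20._⊑_ 𝐀 (I20.𝟎 𝐀) a → I20._⇒_ 𝐀 (I20.𝟎 𝐀) a ≡ I20._′ 𝐀 (I20.𝟎 𝐀)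
lemma5p3 𝐀 a 𝟎⊑a = begin
    𝟎 ⇒ a         ≡⟨ sym (⇒𝟏⇒𝟏 a) ⟩
    (a ⇒ 𝟏) ⇒ 𝟏   ≡⟨ cong (_⇒ 𝟏) (𝟎⊑⇒⇒𝟏 a 𝟎⊑a) ⟩
    𝟏 ⇒ 𝟏         ≡⟨ 𝟏-unitˡ 𝟏 ⟩
    𝟏             ∎
  where
    open I20 𝐀
    open I20-Identities 𝐀
    open ≡-Reasoning
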